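{- Let $N\ge1$, $I=[-N,-1]\cup[1,N]$, $\overline{k}$ an algebraically closed field of characteristic $\ne 2$, and $T\cong\mathbb{G}_m^{I}$ the diagonal torus of $GL_{2N}$ with coordinates $t=(a_i)_{i\in I}$. Let $\varphi:T\to T$ be $\varphi((a_i)_i)=(a_{ -i}^{ -1})_i$, so $T^{\varphi}=\{(a_i): a_ia_{ -i}=1\ \forall i\}$. Let $W$ be the group of permutations of $I$, acting on $T$ by $(w(t))_{w(i)}=a_i$, and $W^{\varphi}=\{w\in W: w(-i)=-w(i)\ \forall i\}$. Let $w\in W^{\varphi}$ be an involution and $t\in T(\overline{k})$ with $t\,w(t)^{ -1}\in T^{\varphi}(\overline{k})$. Then there exists $t'\in T^{\varphi}(\overline{k})$ with $t'\,w(t')^{ -1}=t\,w(t)^{ -1}$. -}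

module Defs where

open import Level using (Level; _⊔_)
open import Algebra.Bundles using (CommutativeRing)
open import Data.Bool using (Bool; not)
open import Data.Fin using (Fin)
open import Data.Nat using (ℕ; _≤_)
open import Data.List using (List; []; _∷_; length)
open import Data.Product using (_×_; _,_; ∃)
open import Function.Bundles using (_↔_; Inverse)
open import Relation.Nullary using (¬_)

-- Index set I = [-N,-1] ∪ [1,N], encoded as (sign , k) with k : Fin N;
-- (true , k) stands for k+1 and (false , k) for -(k+1).
I : ℕ → Set
I N = Bool × Fin N

neg : {N : ℕ} → I N → I N
neg (b , k) = (not b , k)

-- W = group of permutations of I (to = w, from = w⁻¹)
W : ℕ → Set
W N = I N ↔ I N

InWφ : {N : ℕ} → W N → Set
InWφ w = ∀ i → Inverse.to w (neg i) Relation.Binary.PropositionalEquality.≡ neg (Inverse.to w i)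
  where import Relation.Binary.PropositionalEquality

IsInvolution : {N : ℕ} → W N → Set
IsInvolution w = ∀ i → Inverse.to w (Inverse.to w i) Relation.Binary.PropositionalEquality.≡ i
  where import Relation.Binary.PropositionalEquality

module _ {c ℓ : Level} (R : CommutativeRing c ℓ) where
  open CommutativeRing R

  IsField : Set (c ⊔ ℓ)
  IsField = (¬ (1# ≈ 0#)) × (∀ x → ¬ (x ≈ 0#) → ∃ λ y → x * y ≈ 1#)

  CharNot2 : Set ℓ
  CharNot2 = ¬ (1# + 1# ≈ 0#)

  -- monic polynomial with coefficient list [c₀,…,c_{n-1}]:
  -- c₀ + x (c₁ + x (… + x (c_{n-1} + x · 1)))  = xⁿ + c_{n-1}xⁿ⁻¹ + … + c₀
  evalMonic : List Carrier → Carrier → Carrier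
  evalMonic [] x = 1#
  evalMonic (a ∷ as) x = a + x * evalMonic as x

  AlgClosed : Set (c ⊔ ℓ)
  AlgClosed = ∀ (cs : List Carrier) → 1 ≤ length cs → ∃ λ x → evalMonic cs x ≈ 0#

  record Unit : Set (c ⊔ ℓ) where
    field
      val : Carrier
      inv : Carrier
      val*inv : val * inv ≈ 1#
  open Unit public

  mulU : Unit → Unit → Unit
  mulU u v = record
    { val = val u * val v ; inv = inv u * inv v
    ; val*inv = trans (trans (*-assoc (val u) (val v) (inv u * inv v))
        (*-congˡ (trans (sym (*-assoc (val v) (inv u) (inv v)))
          (trans (*-congʳ (*-comm (val v) (inv u)))
            (*-assoc (inv u) (val v) (inv v))))))
        (trans (sym (*-assoc (val u) (inv u) (val v * inv v)))
          (trans (*-cong (val*inv u) (val*inv v)) (*-identityˡ 1#))) }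

  invU : Unit → Unit
  invU u = record { val = inv u ; inv = val u ; val*inv = trans (*-comm (inv u) (val u)) (val*inv u) }

  Torus : ℕ → Set (c ⊔ ℓ)
  Torus N = I N → Unit

  InTφ : {N : ℕ} → Torus N → Set ℓ
  InTφ t = ∀ i → val (t i) * val (t (neg i)) ≈ 1#

  -- action of W on T: (w(t))_{w(i)} = a_i, i.e. (w(t))_j = a_{w⁻¹(j)}
  act : {N : ℕ} → W N → Torus N → Torus N
  act w t j = t (Inverse.from w j)

  twt : {N : ℕ} → W N → Torus N → Torus N
  twt w t j = mulU (t j) (invU (act w t j))

  EqT : {N : ℕ} → Torus N → Torus N → Set ℓ
  EqT s u = ∀ j → val (s j) ≈ val (u j)

{-# OPTIONS --safe #-}
-- Write p i = t i · t (-i); always p (-i) = p i, and the hypothesis t·w(t)⁻¹ ∈ T^φ says exactly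
-- that p is w-invariant.  Hence it suffices to find a w-invariant c with c i · c (-i) = p i ⁻¹,
-- for then t′ = t·c lies in T^φ and t′·w(t′)⁻¹ = t·w(t)⁻¹.  Such a c is built orbitwise.  A
-- w-orbit O = {i , w i} with O ≠ -O is paired with the different orbit -O: put p⁻¹ on one of the
-- two (the one whose element of least absolute value is positive) and 1 on the other.  The only
-- self-paired orbits are O = {i , -i}, where w i = -i; there put a square root of p i ⁻¹ on both
-- points, which exists since the field is algebraically closed.
module Submission where

open import Defs
open import Level using (Level)
open import Algebra.Bundles using (CommutativeRing)
open import Data.Bool using (Bool; true; false; not; if_then_else_)
import Data.Bool.Properties as Bool
open import Data.Fin using (_≤?_)
import Data.Fin.Properties as Fin
open import Data.List using ([]; _∷_)
open import Data.Nat using (ℕ; _≤_; s≤s; z≤n)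
open import Data.Product using (Σ; ∃; _×_; _,_; proj₁; proj₂)
open import Data.Product.Properties using (≡-dec)
open import Data.Sum using ([_,_]′)
open import Function.Bundles using (Inverse)
open import Relation.Nullary using (Dec; yes; no; contradiction)
open import Relation.Binary.PropositionalEquality as ≡ using (_≡_; _≢_; cong; subst; subst₂)

neg-involutive : ∀ {N} (i : I N) → neg (neg i) ≡ i
neg-involutive (b , a) = cong (_, a) (Bool.not-involutive b)

neg-injective : ∀ {N} {i j : I N} → neg i ≡ neg j → i ≡ j
neg-injective {i = i} {j} e = ≡.trans (≡.sym (neg-involutive i)) (≡.trans (cong neg e) (neg-involutive j))

_≟_ : ∀ {N} (i j : I N) → Dec (i ≡ j)
_≟_ = ≡-dec Bool._≟_ Fin._≟_

innerSign : ∀ {N} → I N → I N → Bool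
innerSign (b , a) (b′ , a′) with a ≤? a′
... | yes _ = b
... | no _ = b′

innerSign-neg : ∀ {N} (i j : I N) → innerSign (neg i) (neg j) ≡ not (innerSign i j)
innerSign-neg (b , a) (b′ , a′) with a ≤? a′
... | yes _ = ≡.refl
... | no _ = ≡.refl

innerSign-comm : ∀ {N} (i j : I N) → j ≢ neg i → innerSign i j ≡ innerSign j i
innerSign-comm (b , a) (b′ , a′) j≢-i with a ≤? a′ | a′ ≤? a
... | yes a≤a′ | yes a′≤a with ≡.refl ← Fin.≤-antisym a′≤a a≤a′ = equal-signs b b′ j≢-i
  where
  equal-signs : ∀ b b′ → (b′ , a) ≢ (not b , a) → b ≡ b′
  equal-signs true true _ = ≡.refl
  equal-signs false false _ = ≡.refl
  equal-signs true false ne = contradiction ≡.refl ne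
  equal-signs false true ne = contradiction ≡.refl ne
... | yes _ | no _ = ≡.refl
... | no _ | yes _ = ≡.refl
... | no a≰a′ | no a′≰a = contradiction (Fin.≤-total a a′) [ a≰a′ , a′≰a ]′

module _ {N : ℕ} (w : W N) (w-involutive : IsInvolution w) where
  open Inverse w

  from≡to : ∀ i → from i ≡ to i
  from≡to i = ≡.trans (≡.sym (w-involutive (from i))) (cong to (strictlyInverseˡ i))

module _ {c ℓ : Level} (k : CommutativeRing c ℓ) where
  open CommutativeRing k hiding (refl; sym; trans)
  open CommutativeRing k using () renaming (refl to ≈-refl; sym to ≈-sym; trans to ≈-trans)
  open import Algebra.Solver.CommutativeMonoid *-commutativeMonoid using (solve; _⊜_; _⊕_)
  open import Relation.Binary.Reasoning.Setoid setoid

  1ᵤ : Unit k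
  1ᵤ = record { val = 1# ; inv = 1# ; val*inv = *-identityˡ 1# }

  inv*val : (u : Unit k) → inv u * val u ≈ 1#
  inv*val u = ≈-trans (*-comm _ _) (val*inv u)

  inv-cong : {u v : Unit k} → val u ≈ val v → inv u ≈ inv v
  inv-cong {u} {v} u≈v = begin
    inv u                   ≈⟨ *-identityʳ _ ⟨
    inv u * 1#              ≈⟨ *-congˡ (val*inv v) ⟨
    inv u * (val v * inv v) ≈⟨ *-congˡ (*-congʳ u≈v) ⟨
    inv u * (val u * inv v) ≈⟨ *-assoc _ _ _ ⟨
    inv u * val u * inv v   ≈⟨ *-congʳ (inv*val u) ⟩
    1# * inv v              ≈⟨ *-identityˡ _ ⟩
    inv v                   ∎

  ratio*ratio≈1⇒inv*inv≈ : (a b x y : Unit k) → (val a * inv x) * (val b * inv y) ≈ 1# →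
                           inv a * inv b ≈ inv x * inv y
  ratio*ratio≈1⇒inv*inv≈ a b x y ratio≈1 = begin
    inv a * inv b                                           ≈⟨ *-identityʳ _ ⟨
    inv a * inv b * 1#                                      ≈⟨ *-congˡ ratio≈1 ⟨
    inv a * inv b * ((val a * inv x) * (val b * inv y))     ≈⟨ solve 6 (λ a a⁻¹ b b⁻¹ x⁻¹ y⁻¹ →
      (a⁻¹ ⊕ b⁻¹) ⊕ ((a ⊕ x⁻¹) ⊕ (b ⊕ y⁻¹)) ⊜ ((a⁻¹ ⊕ a) ⊕ (b⁻¹ ⊕ b)) ⊕ (x⁻¹ ⊕ y⁻¹))
      ≈-refl (val a) (inv a) (val b) (inv b) (inv x) (inv y) ⟩
    (inv a * val a) * (inv b * val b) * (inv x * inv y)     ≈⟨ *-congʳ (*-cong (inv*val a) (inv*val b)) ⟩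
    1# * 1# * (inv x * inv y)                               ≈⟨ *-congʳ (*-identityˡ 1#) ⟩
    1# * (inv x * inv y)                                    ≈⟨ *-identityˡ _ ⟩
    inv x * inv y                                           ∎

  AlgClosed⇒sqrt : AlgClosed k → ∀ q → ∃ λ y → y * y ≈ q
  AlgClosed⇒sqrt closed q with closed (- q ∷ 0# ∷ []) (s≤s z≤n)
  ... | y , root = y , (begin
    y * y                           ≈⟨ +-identityʳ _ ⟨
    y * y + 0#                      ≈⟨ +-congˡ (-‿inverseʳ q) ⟨
    y * y + (q - q)                 ≈⟨ +-comm _ _ ⟩
    q - q + y * y                   ≈⟨ +-assoc _ _ _ ⟩
    q + (- q + y * y)               ≈⟨ +-congˡ (+-congˡ (*-congˡ (≈-trans (+-identityˡ _) (*-identityʳ y)))) ⟨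
    q + (- q + y * (0# + y * 1#))   ≈⟨ +-congˡ root ⟩
    q + 0#                          ≈⟨ +-identityʳ q ⟩
    q                               ∎)

  AlgClosed⇒unit-sqrt : AlgClosed k → (u : Unit k) → ∃ λ (v : Unit k) → val v * val v ≈ val u
  AlgClosed⇒unit-sqrt closed u with AlgClosed⇒sqrt closed (val u)
  ... | y , y²≈u = v , y²≈u
    where
    v : Unit k
    v = record { val = y ; inv = y * inv u
               ; val*inv = ≈-trans (≈-sym (*-assoc _ _ _)) (≈-trans (*-congʳ y²≈u) (val*inv u)) }

  module Splitting (sqrt : (u : Unit k) → ∃ λ (v : Unit k) → val v * val v ≈ val u)
                   {N : ℕ} (r : I N → Unit k) (r-neg : ∀ i → val (r (neg i)) ≈ val (r i)) where

    r-positive : ∀ i → val (r (true , proj₂ i)) ≈ val (r i)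
    r-positive (true , a) = ≈-refl
    r-positive (false , a) = r-neg (false , a)

    -- Both points of a pair {i , -i} must get the same square root, so it is taken at the positive one.
    factor : I N → I N → Unit k
    factor i j with j ≟ neg i
    ... | yes _ = proj₁ (sqrt (r (true , proj₂ i)))
    ... | no _ = if innerSign i j then r i else 1ᵤ

    factor-comm : ∀ i j → val (r i) ≈ val (r j) → val (factor i j) ≈ val (factor j i)
    factor-comm i j ri≈rj with j ≟ neg i | i ≟ neg j
    ... | yes ≡.refl | yes _ = ≈-refl
    ... | yes ≡.refl | no i≢--i = contradiction (≡.sym (neg-involutive i)) i≢--i
    ... | no j≢-i | yes ≡.refl = contradiction (≡.sym (neg-involutive j)) j≢-i
    ... | no j≢-i | no _ rewrite innerSign-comm i j j≢-i with innerSign j i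
    ...   | true = ri≈rj
    ...   | false = ≈-refl

    factor-neg : ∀ i j → val (factor i j) * val (factor (neg i) (neg j)) ≈ val (r i)
    factor-neg i j with j ≟ neg i | neg j ≟ neg (neg i)
    ... | yes ≡.refl | yes _ = ≈-trans (proj₂ (sqrt (r (true , proj₂ i)))) (r-positive i)
    ... | yes ≡.refl | no -j≢--i = contradiction ≡.refl -j≢--i
    ... | no j≢-i | yes -j≡--i = contradiction (neg-injective -j≡--i) j≢-i
    ... | no _ | no _ rewrite innerSign-neg i j with innerSign i j
    ...   | true = *-identityʳ _
    ...   | false = ≈-trans (*-identityˡ _) (r-neg i)

    module _ (σ : I N → I N) (σ-involutive : ∀ i → σ (σ i) ≡ i) (σ-neg : ∀ i → σ (neg i) ≡ neg (σ i))
             (r-σ : ∀ i → val (r (σ i)) ≈ val (r i)) where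

      split : I N → Unit k
      split i = factor i (σ i)

      split-σ : ∀ i → val (split (σ i)) ≈ val (split i)
      split-σ i = subst (λ j → val (factor (σ i) j) ≈ val (split i)) (≡.sym (σ-involutive i))
                        (factor-comm (σ i) i (r-σ i))

      split-neg : ∀ i → val (split i) * val (split (neg i)) ≈ val (r i)
      split-neg i rewrite σ-neg i = factor-neg i (σ i)

  _·_ : {N : ℕ} → Torus k N → Torus k N → Torus k N
  (t · s) i = mulU k (t i) (s i)

  normInv : {N : ℕ} → Torus k N → I N → Unit k
  normInv t i = invU k (mulU k (t i) (t (neg i)))

  normInv-neg : ∀ {N} (t : Torus k N) i → val (normInv t (neg i)) ≈ val (normInv t i)
  normInv-neg t i = subst (λ j → inv (t (neg i)) * inv (t j) ≈ inv (t i) * inv (t (neg i)))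
                          (≡.sym (neg-involutive i)) (*-comm _ _)

  ·-InTφ : ∀ {N} (t s : Torus k N) → (∀ i → val (s i) * val (s (neg i)) ≈ val (normInv t i)) →
           InTφ k (t · s)
  ·-InTφ t s s-norm i = begin
    (val (t i) * val (s i)) * (val (t (neg i)) * val (s (neg i)))
      ≈⟨ solve 4 (λ a b a′ b′ → (a ⊕ b) ⊕ (a′ ⊕ b′) ⊜ (a ⊕ a′) ⊕ (b ⊕ b′))
               ≈-refl (val (t i)) (val (s i)) (val (t (neg i))) (val (s (neg i))) ⟩
    (val (t i) * val (t (neg i))) * (val (s i) * val (s (neg i))) ≈⟨ *-congˡ (s-norm i) ⟩
    (val (t i) * val (t (neg i))) * (inv (t i) * inv (t (neg i))) ≈⟨ val*inv (mulU k (t i) (t (neg i))) ⟩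
    1#                                                            ∎

  twt-·-invariant : ∀ {N} (w : W N) (t s : Torus k N) → EqT k (act k w s) s →
                    EqT k (twt k w (t · s)) (twt k w t)
  twt-·-invariant {N} w t s ws≈s j = begin
    (val (t j) * val (s j)) * (inv (t j′) * inv (s j′)) ≈⟨ *-congˡ (*-congˡ (inv-cong {s j′} {s j} (ws≈s j))) ⟩
    (val (t j) * val (s j)) * (inv (t j′) * inv (s j))
      ≈⟨ solve 4 (λ a b a′ b′ → (a ⊕ b) ⊕ (a′ ⊕ b′) ⊜ (a ⊕ a′) ⊕ (b ⊕ b′))
               ≈-refl (val (t j)) (val (s j)) (inv (t j′)) (inv (s j)) ⟩
    (val (t j) * inv (t j′)) * (val (s j) * inv (s j)) ≈⟨ *-congˡ (val*inv (s j)) ⟩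
    (val (t j) * inv (t j′)) * 1#                      ≈⟨ *-identityʳ _ ⟩
    val (t j) * inv (t j′)                             ∎
    where
    j′ : I N
    j′ = Inverse.from w j

  twt-InTφ⇒normInv-invariant : ∀ {N} (w : W N) → InWφ w → IsInvolution w → (t : Torus k N) →
                               InTφ k (twt k w t) → ∀ i → val (normInv t (Inverse.to w i)) ≈ val (normInv t i)
  twt-InTφ⇒normInv-invariant w w∈Wφ w-involutive t twt∈Tφ i =
    ≈-sym (ratio*ratio≈1⇒inv*inv≈ (t i) (t (neg i)) (t (to i)) (t (neg (to i)))
      (subst₂ (λ x y → (val (t i) * inv (t x)) * (val (t (neg i)) * inv (t y)) ≈ 1#)
              (from≡to w w-involutive i) (≡.trans (from≡to w w-involutive (neg i)) (w∈Wφ i)) (twt∈Tφ i)))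
    where open Inverse w using (to)

lemma5p8 : {c ℓ : Level} (k : CommutativeRing c ℓ) → IsField k → AlgClosed k → CharNot2 k →
           (N : ℕ) → 1 ≤ N → (w : W N) → InWφ w → IsInvolution w →
           (t : Torus k N) → InTφ k (twt k w t) →
           Σ (Torus k N) (λ t′ → InTφ k t′ × EqT k (twt k w t′) (twt k w t))
lemma5p8 k _ closed _ N _ w w∈Wφ w-involutive t twt∈Tφ =
  _·_ k t c , ·-InTφ k t c (split-neg σ w-involutive w∈Wφ r-σ) , twt-·-invariant k w t c c-invariant
  where
  open CommutativeRing k using (_≈_)
  open Splitting k (AlgClosed⇒unit-sqrt k closed) (normInv k t) (normInv-neg k t)
  σ : I N → I N
  σ = Inverse.to w
  r-σ : ∀ i → val (normInv k t (σ i)) ≈ val (normInv k t i)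
  r-σ = twt-InTφ⇒normInv-invariant k w w∈Wφ w-involutive t twt∈Tφ
  c : Torus k N
  c = split σ w-involutive w∈Wφ r-σ
  c-invariant : EqT k (act k w c) c
  c-invariant j rewrite from≡to w w-involutive j = split-σ σ w-involutive w∈Wφ r-σ j
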